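{- Let $k\ge2$ and $\sigma=\sigma_0\sigma_1\dots\sigma_{k-1}\in\{+,-\}^k$, and let $\sigma^R=\sigma_{k-1}\dots\sigma_1\sigma_0$. Then for every permutation $\pi$, $\pi\in\mathcal A(\Sigma_\sigma)$ if and only if $\pi^c\in\mathcal A(\Sigma_{\sigma^R})$, and $\pi\in\mathcal P(\Sigma_\sigma)$ if and only if $\pi^c\in\mathcal P(\Sigma_{\sigma^R})$.
   Context: Let $T^-_\sigma=\{t:\sigma_t=-\}$. Let $\mathcal W_k$ be the set of infinite words $s=s_1s_2\dots$ over $\{0,\dots,k-1\}$, $s_{[i,\infty)}=s_is_{i+1}\dots$. The order $\prec_\sigma$ on $\mathcal W_k$: for $s\ne t$, with $j$ the first index where $s_j\neq t_j$ and $c=|\{i<j:s_i\in T^-_\sigma\}|$, $s\prec_\sigma t$ iff ($c$ even and $s_j<t_j$) or ($c$ odd and $s_j>t_j$). $\Sigma_\sigma(s_1s_2\dots)=s_2s_3\dots$. For $s\in\mathcal W_k$ and $n\ge1$ such that $s,\Sigma_\sigma(s),\dots,\Sigma_\sigma^{n-1}(s)$ are distinct, $\mathrm{Pat}(s,\Sigma_\sigma,n)\in\mathcal S_n$ is the permutation whose entries are in the same relative order (w.r.t. $\prec_\sigma$) as $s,\Sigma_\sigma(s),\dots,\Sigma_\sigma^{n-1}(s)$; $\mathcal A(\Sigma_\sigma)$ is the set of all such permutations (allowed patterns). $\mathcal W_{k,n}$ is the set of words $(s_1\dots s_n)^\infty$ with $s_1\dots s_n$ primitive (not a power of a shorter word);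 for $s\in\mathcal W_{k,n}$, $\Pi_\sigma(s)=\mathrm{Pat}(s,\Sigma_\sigma,n)$, and $\mathcal P(\Sigma_\sigma)=\{\Pi_\sigma(s):n\ge1,\ s\in\mathcal W_{k,n}\}$ (periodic patterns). For $\pi\in\mathcal S_n$, the complement $\pi^c$ is given by $\pi^c_i=n+1-\pi_i$. -}

module Defs where

open import Data.Nat using (ℕ; zero; suc; _+_; _≤_; _<_)
open import Data.Nat.Divisibility using (_∣_)
open import Data.Fin as F using (Fin; opposite)
open import Data.Fin.Permutation using (Permutation′; _⟨$⟩ʳ_)
open import Data.Bool using (Bool; true; false; if_then_else_)
open import Data.Product using (Σ; ∃; _×_)
open import Data.Sum using (_⊎_)
open import Relation.Binary.PropositionalEquality using (_≡_)
open import Relation.Nullary using (¬_)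
open import Function.Bundles using (_⇔_)

data Sign : Set where
  plus minus : Sign

SignSeq : ℕ → Set
SignSeq k = Fin k → Sign

reverseSeq : ∀ {k} → SignSeq k → SignSeq k
reverseSeq σ i = σ (opposite i)

-- infinite words over {0,…,k-1}, indexed from 0 (s 0 = s₁ of the paper)
Word : ℕ → Set
Word k = ℕ → Fin k

isMinus : Sign → ℕ
isMinus plus  = 0
isMinus minus = 1

negCount : ∀ {k} → SignSeq k → Word k → ℕ → ℕ
negCount σ s zero    = 0
negCount σ s (suc j) = negCount σ s j + isMinus (σ (s j))

_≺[_]_ : ∀ {k} → Word k → SignSeq k → Word k → Set
s ≺[ σ ] t = Σ ℕ λ j →
  (∀ i → i < j → s i ≡ t i) × ¬ (s j ≡ t j) ×
  ((2 ∣ negCount σ s j × s j F.< t j) ⊎ (¬ (2 ∣ negCount σ s j) × t j F.< s j))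

shift : ∀ {k} → Word k → Word k
shift s i = s (suc i)

shift^ : ∀ {k} → ℕ → Word k → Word k
shift^ zero    s = s
shift^ (suc m) s = shift (shift^ m s)

-- complement of a permutation (0-based: π^c i = n-1-π i)
complement : ∀ {n} → Permutation′ n → Fin n → Fin n
complement π i = opposite (π ⟨$⟩ʳ i)

IsPattern : ∀ {k n} → SignSeq k → Word k → (Fin n → Fin n) → Set
IsPattern {n = n} σ s f =
  ∀ (i j : Fin n) → (f i F.< f j) ⇔ (shift^ (F.toℕ i) s ≺[ σ ] shift^ (F.toℕ j) s)

Allowed : ∀ {k n} → SignSeq k → (Fin n → Fin n) → Set
Allowed {k} {n} σ f = 1 ≤ n × ∃ λ (s : Word k) → IsPattern σ s f

IsPrimitivePeriodic : ∀ {k} → ℕ → Word k → Set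
IsPrimitivePeriodic n s =
  1 ≤ n × (∀ i → s (i + n) ≡ s i) ×
  (∀ d → 1 ≤ d → d < n → d ∣ n → ¬ (∀ i → i + d < n → s (i + d) ≡ s i))

Periodic : ∀ {k n} → SignSeq k → (Fin n → Fin n) → Set
Periodic {k} {n} σ f = ∃ λ (s : Word k) → IsPrimitivePeriodic n s × IsPattern σ s f

-- Complement every letter, a ↦ k−1−a. The letter k−1−a has the same sign
-- under σ^R as a has under σ, so at the first difference of two words their
-- complements have seen the same number of minus letters, while the two
-- letters compared there swap order: complementation reverses ≺, turning ≺_σ
-- into the opposite of ≺_{σ^R}. Hence the complemented word realises the
-- complemented pattern, and complementation preserves primitive periodicity.
module Submission where

open import Defs
open import Data.Nat using (ℕ; _≤_; zero; suc; _+_; _<_; s≤s)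
open import Data.Nat.Properties using (∸-monoʳ-<; n<1+n; m<n⇒m<1+n)
open import Data.Nat.Divisibility using (_∣_)
open import Data.Fin as F using (Fin; opposite; toℕ)
open import Data.Fin.Properties using (opposite-prop; opposite-involutive; toℕ<n)
open import Data.Fin.Permutation using (Permutation′; _⟨$⟩ʳ_)
open import Data.Product using (_×_; _,_)
open import Data.Sum using (_⊎_; inj₁; inj₂)
open import Function.Base using (_∘_)
open import Function.Bundles using (_⇔_; mk⇔; Equivalence)
open import Relation.Binary.PropositionalEquality
open import Relation.Nullary using (¬_; contraposition)

private
  variable
    k n : ℕ

opposite-injective : {a b : Fin n} → opposite a ≡ opposite b → a ≡ b
opposite-injective {a = a} {b} eq =
  trans (sym (opposite-involutive a)) (trans (cong opposite eq) (opposite-involutive b))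

opposite-reverses-< : {a b : Fin n} → a F.< b → opposite b F.< opposite a
opposite-reverses-< {a = a} {b} a<b rewrite opposite-prop a | opposite-prop b =
  ∸-monoʳ-< (s≤s a<b) (toℕ<n b)

opposite-reflects-< : {a b : Fin n} → opposite b F.< opposite a → a F.< b
opposite-reflects-< {a = a} {b} lt =
  subst₂ F._<_ (opposite-involutive a) (opposite-involutive b) (opposite-reverses-< lt)

Reverses : SignSeq k → SignSeq k → Set
Reverses σ τ = ∀ a → τ (opposite a) ≡ σ a

reverseSeq-reverses : (σ : SignSeq k) → Reverses σ (reverseSeq σ)
reverseSeq-reverses σ a = cong σ (opposite-involutive a)

reverses-sym : {σ τ : SignSeq k} → Reverses σ τ → Reverses τ σ
reverses-sym {σ = σ} {τ} rev a =
  trans (sym (rev (opposite a))) (cong τ (opposite-involutive a))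

mirror : Word k → Word k
mirror s i = opposite (s i)

≗mirror-sym : {u u′ : Word k} → u′ ≗ mirror u → u ≗ mirror u′
≗mirror-sym {u = u} eq i = trans (sym (opposite-involutive (u i))) (cong opposite (sym (eq i)))

shift^-mirror : (s : Word k) (m : ℕ) → shift^ m (mirror s) ≗ mirror (shift^ m s)
shift^-mirror s zero    i = refl
shift^-mirror s (suc m) i = shift^-mirror s m (suc i)

negCount-prefix : (ρ : SignSeq k) {u v : Word k} (j : ℕ) →
                  (∀ i → i < j → u i ≡ v i) → negCount ρ u j ≡ negCount ρ v j
negCount-prefix ρ zero    agree = refl
negCount-prefix ρ (suc j) agree =
  cong₂ _+_ (negCount-prefix ρ j (λ i i<j → agree i (m<n⇒m<1+n i<j)))
            (cong (isMinus ∘ ρ) (agree j (n<1+n j)))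

negCount-mirror : {σ τ : SignSeq k} → Reverses σ τ → {u u′ : Word k} →
                  u′ ≗ mirror u → negCount τ u′ ≗ negCount σ u
negCount-mirror rev eq zero    = refl
negCount-mirror {τ = τ} rev {u} eq (suc j) =
  cong₂ _+_ (negCount-mirror rev eq j) (cong isMinus (trans (cong τ (eq j)) (rev (u j))))

≺-mirror : {σ τ : SignSeq k} → Reverses σ τ → {u v u′ v′ : Word k} →
           u′ ≗ mirror u → v′ ≗ mirror v → u ≺[ σ ] v → v′ ≺[ τ ] u′
≺-mirror {σ = σ} {τ} rev {u} {v} {u′} {v′} eu ev (j , agree , differ , compare) =
  j , agree′ , differ′ , compare′ compare
  where
  agree′ : ∀ i → i < j → v′ i ≡ u′ i
  agree′ i i<j = trans (ev i) (trans (cong opposite (sym (agree i i<j))) (sym (eu i)))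

  differ′ : v′ j ≢ u′ j
  differ′ eq = differ (sym (opposite-injective (trans (sym (ev j)) (trans eq (eu j)))))

  sameCount : negCount τ v′ j ≡ negCount σ u j
  sameCount = trans (negCount-mirror rev ev j) (sym (negCount-prefix σ j agree))

  compare′ : (2 ∣ negCount σ u j × u j F.< v j) ⊎ (¬ 2 ∣ negCount σ u j × v j F.< u j) →
             (2 ∣ negCount τ v′ j × v′ j F.< u′ j) ⊎ (¬ 2 ∣ negCount τ v′ j × u′ j F.< v′ j)
  compare′ (inj₁ (even , u<v)) =
    inj₁ (subst (2 ∣_) (sym sameCount) even ,
          subst₂ F._<_ (sym (ev j)) (sym (eu j)) (opposite-reverses-< u<v))
  compare′ (inj₂ (odd , v<u)) =
    inj₂ (contraposition (subst (2 ∣_) sameCount) odd ,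
          subst₂ F._<_ (sym (eu j)) (sym (ev j)) (opposite-reverses-< v<u))

module _ {σ τ : SignSeq k} (rev : Reverses σ τ) where

  IsPattern-mirror : (s : Word k) {f g : Fin n → Fin n} → g ≗ opposite ∘ f →
                     IsPattern σ s f → IsPattern τ (mirror s) g
  IsPattern-mirror s {f} {g} eg pat i j = mk⇔ to from
    where
    S : Fin n → Word k
    S i = shift^ (toℕ i) s

    S′ : Fin n → Word k
    S′ i = shift^ (toℕ i) (mirror s)

    to : g i F.< g j → S′ i ≺[ τ ] S′ j
    to gi<gj = ≺-mirror rev (shift^-mirror s (toℕ j)) (shift^-mirror s (toℕ i))
      (Equivalence.to (pat j i) (opposite-reflects-< (subst₂ F._<_ (eg i) (eg j) gi<gj)))

    from : S′ i ≺[ τ ] S′ j → g i F.< g j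
    from Si≺Sj = subst₂ F._<_ (sym (eg i)) (sym (eg j)) (opposite-reverses-<
      (Equivalence.from (pat j i)
        (≺-mirror (reverses-sym rev) (≗mirror-sym (shift^-mirror s (toℕ i)))
                  (≗mirror-sym (shift^-mirror s (toℕ j))) Si≺Sj)))

  IsPrimitivePeriodic-mirror : {s : Word k} → IsPrimitivePeriodic n s →
                               IsPrimitivePeriodic n (mirror s)
  IsPrimitivePeriodic-mirror (n≥1 , periodic , aperiodic) =
    n≥1 , cong opposite ∘ periodic ,
    λ d d≥1 d<n d∣n shorter → aperiodic d d≥1 d<n d∣n (λ i lt → opposite-injective (shorter i lt))

  Allowed-mirror : {f g : Fin n → Fin n} → g ≗ opposite ∘ f → Allowed σ f → Allowed τ g
  Allowed-mirror eg (n≥1 , s , pat) = n≥1 , mirror s , IsPattern-mirror s eg pat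

  Periodic-mirror : {f g : Fin n → Fin n} → g ≗ opposite ∘ f → Periodic σ f → Periodic τ g
  Periodic-mirror eg (s , prim , pat) =
    mirror s , IsPrimitivePeriodic-mirror prim , IsPattern-mirror s eg pat

proposition2p7 : (k : ℕ) → 2 ≤ k → (σ : SignSeq k) → (n : ℕ) → (π : Permutation′ n) →
    (Allowed σ (π ⟨$⟩ʳ_) ⇔ Allowed (reverseSeq σ) (complement π))
    × (Periodic σ (π ⟨$⟩ʳ_) ⇔ Periodic (reverseSeq σ) (complement π))
proposition2p7 k _ σ n π =
  mk⇔ (Allowed-mirror rev (λ _ → refl)) (Allowed-mirror (reverses-sym rev) uncomplement) ,
  mk⇔ (Periodic-mirror rev (λ _ → refl)) (Periodic-mirror (reverses-sym rev) uncomplement)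
  where
  rev : Reverses σ (reverseSeq σ)
  rev = reverseSeq-reverses σ

  uncomplement : (π ⟨$⟩ʳ_) ≗ opposite ∘ complement π
  uncomplement i = sym (opposite-involutive (π ⟨$⟩ʳ i))
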